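{- Let $A$ be a forest automaton and let $\varphi$ be a live execution property for $A$. Then there exists a set $L$ of complemented pairs over $A$ such that $(A,L)$ is a live automaton and $\mathit{lexecs}(A,L)=\varphi$.
   Context: An automaton $A$ has a set of states $\mathit{states}(A)$, nonempty start states, actions, and a transition relation $\mathit{steps}(A)\subseteq\mathit{states}(A)\times\mathit{acts}(A)\times\mathit{states}(A)$. An execution is a finite or infinite alternating sequence $s_0a_1s_1\ldots$ starting in a start state with each $(s_i,a_{i+1},s_{i+1})\in\mathit{steps}(A)$ (ending in a state if finite); $\alpha<\alpha'$ means proper prefix; $\mathit{execs}^\omega(A)$ is the set of infinite executions. $A$ is a forest automaton if for each reachable state $s$ there is exactly one finite execution of $A$ whose last state is $s$. A live execution property is a set $\varphi\subseteq\mathit{execs}^\omega(A)$ such that every finite execution has a proper extension in $\varphi$. A complemented pair is $p=\langle p.\mathsf{R},p.\mathsf{G}\rangle$ with $p.\mathsf{R},p.\mathsf{G}\subseteq\mathit{states}(A)$; an infinite execution $\alpha$ satisfies $p$ ($\alpha\models p$) iff, if infinitely many positions of $\alpha$ carry states in $p.\mathsf{R}$, then infinitely many carry states in $p.\mathsf{G}$. $(A,L)$ is a live automaton if $L$ is a set (any cardinality) of complemented pairs such that each finite execution has a proper infinite extension execution satisfying all pairs of $L$; $\mathit{lexecs}(A,L)=\{\alpha\in\mathit{execs}^\omega(A)\mid\forall p\in L:\alpha\models p\}$. -}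

module Defs where

open import Level using (Level; 0ℓ) renaming (suc to lsuc)
open import Data.Nat using (ℕ; zero; suc; _≤_; _<_)
open import Data.List using (List; []; _∷_; length; lookup)
open import Data.Fin using (Fin; toℕ)
open import Data.Product using (Σ; ∃; _×_; _,_; proj₁; proj₂)
open import Data.Unit using (⊤)
open import Relation.Binary.PropositionalEquality using (_≡_)

record Automaton : Set₁ where
  field
    State          : Set
    Act            : Set
    start          : State → Set
    startNonempty  : ∃ λ s → start s
    steps          : State → Act → State → Set
open Automaton public

module _ (A : Automaton) where

  -- Raw finite sequence s₀ a₁ s₁ … aₙ sₙ : first state and list of (action, state).
  record FSeq : Set where
    constructor fseq
    field
      first : State A
      trail : List (Act A × State A)
  open FSeq public

  lastFrom : State A → List (Act A × State A) → State A
  lastFrom s []             = s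
  lastFrom s ((_ , t) ∷ xs) = lastFrom t xs

  lastState : FSeq → State A
  lastState α = lastFrom (first α) (trail α)

  chainFrom : State A → List (Act A × State A) → Set
  chainFrom s []             = ⊤
  chainFrom s ((a , t) ∷ xs) = steps A s a t × chainFrom t xs

  IsFExec : FSeq → Set
  IsFExec α = start A (first α) × chainFrom (first α) (trail α)

  -- Raw infinite sequence s₀ a₁ s₁ a₂ …; act i is the action between st i and st (suc i).
  record ISeq : Set where
    constructor iseq
    field
      st  : ℕ → State A
      act : ℕ → Act A
  open ISeq public

  IsIExec : ISeq → Set
  IsIExec α = start A (st α 0) × (∀ i → steps A (st α i) (act α i) (st α (suc i)))

  _≈ω_ : ISeq → ISeq → Set
  α ≈ω β = (∀ i → st α i ≡ st β i) × (∀ i → act α i ≡ act β i)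

  _≺_ : FSeq → ISeq → Set
  α ≺ β = (first α ≡ st β 0) ×
          (∀ (i : Fin (length (trail α))) →
             lookup (trail α) i ≡ (act β (toℕ i) , st β (suc (toℕ i))))

  Reachable : State A → Set
  Reachable s = Σ FSeq λ α → IsFExec α × lastState α ≡ s

  IsForest : Set
  IsForest = ∀ s → Reachable s →
    Σ FSeq λ α → (IsFExec α × lastState α ≡ s) ×
      (∀ β → IsFExec β → lastState β ≡ s → β ≡ α)

  -- an execution property: a subset of execs^ω(A); since infinite sequences are
  -- represented as functions, a subset must respect pointwise equality of sequences
  IsExecProperty : (ISeq → Set) → Set
  IsExecProperty φ = (∀ α → φ α → IsIExec α) × (∀ α β → α ≈ω β → φ α → φ β)

  IsLiveExecProperty : (ISeq → Set) → Set
  IsLiveExecProperty φ = IsExecProperty φ ×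
    (∀ α → IsFExec α → Σ ISeq λ β → φ β × α ≺ β)

  record CPair : Set₁ where
    constructor ⟨_,_⟩
    field
      R : State A → Set
      G : State A → Set
  open CPair public

  InfOften : (State A → Set) → ISeq → Set
  InfOften P α = ∀ n → ∃ λ m → n ≤ m × P (st α m)

  _⊨_ : ISeq → CPair → Set
  α ⊨ p = InfOften (R p) α → InfOften (G p) α

  -- a set (any cardinality) of complemented pairs, given by its membership predicate
  PairSet : Set₂
  PairSet = CPair → Set₁

  lexecs : PairSet → ISeq → Set₁
  lexecs L α = IsIExec α × (∀ p → L p → α ⊨ p)

  IsLiveAutomaton : PairSet → Set₁
  IsLiveAutomaton L = ∀ α → IsFExec α → Σ ISeq λ β → α ≺ β × lexecs L β

-- The pairs satisfied by every execution in φ already carve out φ. If an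
-- execution α of a forest automaton is not in φ, take the pair whose red states
-- are the states of α and whose green set is empty. In a forest automaton a
-- reachable state determines the finite execution leading to it, so an
-- execution visiting states of α infinitely often shares arbitrarily long
-- prefixes with α and hence is α. Thus every execution in φ satisfies the pair,
-- while α violates it; turning this contrapositive around needs excluded middle.
module Submission where

open import Defs
open import Level using (Level; Lift; lift; lower; 0ℓ) renaming (suc to lsuc)
open import Axiom.ExcludedMiddle using (ExcludedMiddle)
open import Data.Product using (Σ; ∃; _×_; _,_; proj₁; proj₂)
open import Data.Product.Properties using (,-injectiveˡ; ,-injectiveʳ)
open import Function.Bundles using (_⇔_; mk⇔)
open import Data.Nat using (ℕ; zero; suc; _≤_; _<_; s≤s)
open import Data.Nat.Properties using (≤-refl)
open import Data.List using (List; []; _∷_; length)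
open import Data.List.Properties using (∷-injective)
open import Data.Unit using (tt)
open import Data.Empty using (⊥; ⊥-elim)
open import Relation.Nullary using (¬_)
open import Relation.Nullary.Decidable using (decidable-stable)
open import Relation.Binary.PropositionalEquality using (_≡_; refl; sym; trans; cong)

module _ {A : Automaton} where

  shift : ISeq A → ISeq A
  shift γ = iseq (λ i → st γ (suc i)) (λ i → act γ (suc i))

  trailUpTo : ISeq A → ℕ → List (Act A × State A)
  trailUpTo γ zero    = []
  trailUpTo γ (suc n) = (act γ 0 , st γ 1) ∷ trailUpTo (shift γ) n

  prefix : ISeq A → ℕ → FSeq A
  prefix γ n = fseq (st γ 0) (trailUpTo γ n)

  length-trailUpTo : ∀ γ n → length (trailUpTo γ n) ≡ n
  length-trailUpTo γ zero    = refl
  length-trailUpTo γ (suc n) = cong suc (length-trailUpTo (shift γ) n)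

  lastState-prefix : ∀ γ n → lastState A (prefix γ n) ≡ st γ n
  lastState-prefix γ zero    = refl
  lastState-prefix γ (suc n) = lastState-prefix (shift γ) n

  chainFrom-trailUpTo : ∀ γ → (∀ i → steps A (st γ i) (act γ i) (st γ (suc i))) →
                        ∀ n → chainFrom A (st γ 0) (trailUpTo γ n)
  chainFrom-trailUpTo γ step zero    = tt
  chainFrom-trailUpTo γ step (suc n) = step 0 , chainFrom-trailUpTo (shift γ) (λ i → step (suc i)) n

  prefix-isFExec : ∀ γ → IsIExec A γ → ∀ n → IsFExec A (prefix γ n)
  prefix-isFExec γ (start₀ , step) n = start₀ , chainFrom-trailUpTo γ step n

  trailUpTo-≡⇒agree : ∀ γ α n → trailUpTo γ n ≡ trailUpTo α n → ∀ j → j < n →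
                      act γ j ≡ act α j × st γ (suc j) ≡ st α (suc j)
  trailUpTo-≡⇒agree γ α (suc n) eq j j<n with ∷-injective eq
  trailUpTo-≡⇒agree γ α (suc n) eq zero    _         | head≡ , _ =
    ,-injectiveˡ head≡ , ,-injectiveʳ head≡
  trailUpTo-≡⇒agree γ α (suc n) eq (suc j) (s≤s j<n) | _ , tail≡ =
    trailUpTo-≡⇒agree (shift γ) (shift α) n tail≡ j j<n

  commonPrefixes⇒≈ω : ∀ γ α → (∀ n → ∃ λ m → n ≤ m × prefix γ m ≡ prefix α m) → _≈ω_ A γ α
  commonPrefixes⇒≈ω γ α common = st≡ , act≡
    where
    agreeBelow : ∀ j → act γ j ≡ act α j × st γ (suc j) ≡ st α (suc j)
    agreeBelow j with common (suc j)
    ... | m , j<m , prefix≡ = trailUpTo-≡⇒agree γ α m (cong (trail) prefix≡) j j<m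

    act≡ : ∀ i → act γ i ≡ act α i
    act≡ i = proj₁ (agreeBelow i)

    st≡ : ∀ i → st γ i ≡ st α i
    st≡ zero    = cong (first) (proj₂ (proj₂ (common 0)))
    st≡ (suc i) = proj₂ (agreeBelow i)

  forest⇒prefix-unique : IsForest A → ∀ γ α → IsIExec A γ → IsIExec A α →
                         ∀ m k → st γ m ≡ st α k → prefix γ m ≡ prefix α k
  forest⇒prefix-unique forest γ α γ-exec α-exec m k st≡ =
    trans (unique (prefix γ m) (prefix-isFExec γ γ-exec m) (trans (lastState-prefix γ m) st≡))
          (sym (unique (prefix α k) (prefix-isFExec α α-exec k) (lastState-prefix α k)))
    where
    unique = proj₂ (proj₂ (forest (st α k)
               (prefix α k , prefix-isFExec α α-exec k , lastState-prefix α k)))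

  prefix-≡⇒length-≡ : ∀ γ α m k → prefix γ m ≡ prefix α k → m ≡ k
  prefix-≡⇒length-≡ γ α m k prefix≡ =
    trans (sym (length-trailUpTo γ m))
          (trans (cong (λ p → length (trail p)) prefix≡) (length-trailUpTo α k))

  finitelyOftenIn : ISeq A → CPair A
  finitelyOftenIn α = ⟨ (λ s → ∃ λ k → st α k ≡ s) , (λ _ → ⊥) ⟩

  ¬⊨finitelyOftenIn : ∀ α → ¬ _⊨_ A α (finitelyOftenIn α)
  ¬⊨finitelyOftenIn α sat with sat (λ n → n , ≤-refl , n , refl) 0
  ... | _ , _ , ()

  forest⇒oftenIn⇒≈ω : IsForest A → ∀ γ α → IsIExec A γ → IsIExec A α →
                          InfOften A (R (finitelyOftenIn α)) γ → _≈ω_ A γ α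
  forest⇒oftenIn⇒≈ω forest γ α γ-exec α-exec often = commonPrefixes⇒≈ω γ α common
    where
    common : ∀ n → ∃ λ m → n ≤ m × prefix γ m ≡ prefix α m
    common n with often n
    ... | m , n≤m , k , visit with forest⇒prefix-unique forest γ α γ-exec α-exec m k (sym visit)
    ... | prefix≡ with prefix-≡⇒length-≡ γ α m k prefix≡
    ... | refl = m , n≤m , prefix≡

theorem17 : (lem : ∀ {ℓ : Level} → ExcludedMiddle ℓ) →
    (A : Automaton) → IsForest A → (φ : ISeq A → Set) → IsLiveExecProperty A φ →
    Σ (PairSet A) λ L → IsLiveAutomaton A L × (∀ α → IsIExec A α → (lexecs A L α ⇔ φ α))
theorem17 lem A forest φ ((φ⊆execs , φ-resp) , live) =
  L , isLive , λ α α-exec → mk⇔ (lexecs⊆φ α α-exec) (φ⊆lexecs α)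
  where
  L : PairSet A
  L p = Lift (lsuc 0ℓ) (∀ γ → φ γ → _⊨_ A γ p)

  φ⊆lexecs : ∀ α → φ α → lexecs A L α
  φ⊆lexecs α φα = φ⊆execs α φα , λ p p∈L → lower p∈L α φα

  isLive : IsLiveAutomaton A L
  isLive α α-exec with live α α-exec
  ... | β , φβ , α≺β = β , α≺β , φ⊆lexecs β φβ

  lexecs⊆φ : ∀ α → IsIExec A α → lexecs A L α → φ α
  lexecs⊆φ α α-exec (_ , sat) = decidable-stable lem λ α∉φ →
    ¬⊨finitelyOftenIn α (sat (finitelyOftenIn α) (lift λ γ φγ often →
      ⊥-elim (α∉φ (φ-resp γ α (forest⇒oftenIn⇒≈ω forest γ α (φ⊆execs γ φγ) α-exec often) φγ))))
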